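{- Let $G$ be a prime graph on at least $5$ vertices, and let $a,b,c$ be distinct vertices of $G$. Then there exists a sequence $(x_1,\dots,x_m)$ of vertices in $V(G)\setminus\{a,b\}$ such that $G*x_1*x_2*\cdots*x_m$ contains the path $acb$ as an induced subgraph.
   Context: A connected graph $G$ is prime if there is no partition $(X,Y)$ of $V(G)$ with $|X|,|Y|\ge 2$ such that the edges between $X$ and $Y$ are exactly all edges between some nonempty $X'\subseteq X$ and $Y'\subseteq Y$. For a vertex $x$, $G*x$ is the graph obtained by complementing the subgraph induced on the neighbourhood of $x$ (local complementation); $G*x_1*\cdots*x_m$ applies these successively. -}

module Defs where

open import Data.Nat using (ℕ; suc; _≤_)
open import Data.Fin using (Fin)
open import Data.Bool using (Bool; true; false; not; if_then_else_; _∧_)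
open import Data.List using (List; []; _∷_; foldr)
open import Data.Product using (Σ; _×_; ∃; ∃-syntax)
open import Relation.Binary.PropositionalEquality using (_≡_; _≢_)
open import Relation.Nullary using (¬_; Dec; yes; no)
open import Relation.Nullary.Decidable using (⌊_⌋)
open import Data.Fin using (_≟_)
open import Function.Bundles using (_⇔_)
import Data.Empty
import Data.Bool.Properties
import Relation.Binary.PropositionalEquality

record Graph (n : ℕ) : Set where
  field
    adj   : Fin n → Fin n → Bool
    sym   : ∀ u v → adj u v ≡ adj v u
    irrefl : ∀ u → adj u u ≡ false

open Graph public

Adj : ∀ {n} → Graph n → Fin n → Fin n → Set
Adj G u v = adj G u v ≡ true

IsWalk : ∀ {n} → Graph n → Fin n → List (Fin n) → Fin n → Set
IsWalk G u []       v = u ≡ v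
IsWalk G u (w ∷ ws) v = Adj G u w × IsWalk G w ws v

Connected : ∀ {n} → Graph n → Set
Connected {n} G = ∀ (u v : Fin n) → ∃[ ws ] IsWalk G u ws v

VSet : ℕ → Set
VSet n = Fin n → Bool

_∈ₛ_ : ∀ {n} → Fin n → VSet n → Set
x ∈ₛ S = S x ≡ true

AtLeastTwo : ∀ {n} → VSet n → Set
AtLeastTwo S = ∃[ u ] ∃[ v ] (u ≢ v × u ∈ₛ S × v ∈ₛ S)

NonEmpty : ∀ {n} → VSet n → Set
NonEmpty S = ∃[ u ] u ∈ₛ S

_⊆ₛ_ : ∀ {n} → VSet n → VSet n → Set
A ⊆ₛ B = ∀ x → x ∈ₛ A → x ∈ₛ B

IsSplit : ∀ {n} → Graph n → VSet n → Set
IsSplit {n} G X =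
  AtLeastTwo X × AtLeastTwo (λ v → not (X v)) ×
  ∃[ X' ] ∃[ Y' ] (X' ⊆ₛ X × Y' ⊆ₛ (λ v → not (X v)) × NonEmpty X' × NonEmpty Y' ×
    (∀ (x y : Fin n) → x ∈ₛ X → X y ≡ false →
       (Adj G x y ⇔ (x ∈ₛ X' × y ∈ₛ Y'))))

Prime : ∀ {n} → Graph n → Set
Prime {n} G = Connected G × (∀ (X : VSet n) → ¬ IsSplit G X)

localComp : ∀ {n} → Graph n → Fin n → Graph n
localComp {n} G x = record { adj = a ; sym = s ; irrefl = i }
  where
    flip? : Fin n → Fin n → Bool
    flip? u v = adj G x u ∧ adj G x v ∧ not ⌊ u ≟ v ⌋
    a : Fin n → Fin n → Bool
    a u v = if flip? u v then not (adj G u v) else adj G u v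
    flip-sym : ∀ u v → flip? u v ≡ flip? v u
    flip-sym u v with adj G x u | adj G x v | u ≟ v | v ≟ u
    ... | false | false | _ | _ = Relation.Binary.PropositionalEquality.refl
    ... | false | true  | _ | _ = Relation.Binary.PropositionalEquality.refl
    ... | true  | false | _ | _ = Relation.Binary.PropositionalEquality.refl
    ... | true  | true  | yes _ | yes _ = Relation.Binary.PropositionalEquality.refl
    ... | true  | true  | no _ | no _ = Relation.Binary.PropositionalEquality.refl
    ... | true  | true  | yes p | no q = Data.Empty.⊥-elim (q (Relation.Binary.PropositionalEquality.sym p))
    ... | true  | true  | no p | yes q = Data.Empty.⊥-elim (p (Relation.Binary.PropositionalEquality.sym q))
    s : ∀ u v → a u v ≡ a v u
    s u v rewrite flip-sym u v | sym G u v = Relation.Binary.PropositionalEquality.refl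
    i : ∀ u → a u u ≡ false
    i u with u ≟ u
    ... | no ¬p = Data.Empty.⊥-elim (¬p Relation.Binary.PropositionalEquality.refl)
    ... | yes _ with adj G x u
    ...   | true = irrefl G u
    ...   | false = irrefl G u

localCompSeq : ∀ {n} → Graph n → List (Fin n) → Graph n
localCompSeq G []       = G
localCompSeq G (x ∷ xs) = localCompSeq (localComp G x) xs

-- The path a - c - b is an induced subgraph (a, b, c assumed distinct).
InducedPath : ∀ {n} → Graph n → Fin n → Fin n → Fin n → Set
InducedPath G a c b = Adj G a c × Adj G c b × adj G a b ≡ false

-- Deleting a vertex s from a prime graph on at least four vertices leaves it
-- connected: otherwise, with c and t in different parts of G − s and a fourth
-- vertex w, the component of t (if it contains w) or the rest of G − s (if not)
-- would be one side of a split.  So c is joined to a by a walk avoiding b.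
-- After shortcutting chords, such a walk c v₁ v₂ … has no neighbours of c or
-- v₁ further along; local complementation at v₁ then makes c adjacent to v₂
-- and leaves the rest of the walk intact.  Iterating makes c adjacent to a;
-- the same along a walk avoiding a (which local complementations away from a
-- preserve) then makes c adjacent to b while keeping ca.  Finally, if ab is an
-- edge, local complementation at c removes it.

module Submission where

open import Defs hiding (sym)
open import Data.Nat using (ℕ; zero; suc; _≤_; _<_; z≤n; s<s)
open import Data.Nat.Properties using (≤-<-trans; <⇒≤; <⇒≱; n<1+n; m<n⇒m<1+n)
open import Data.Nat.Induction using (<-wellFounded)
open import Induction.WellFounded using (Acc; acc)
open import Data.Fin using (Fin; _≟_)
import Data.Fin as Fin
open import Data.Fin.Properties using (any?; all?; ¬∀⟶∃¬; pigeonhole; <⇒≢)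
open import Data.Fin.Subset using (Subset; ∣_∣)
import Data.Fin.Subset as Subset
open import Data.Fin.Subset.Properties using (p⊂q⇒∣p∣<∣q∣; ∣p∣≤n)
open import Data.Vec using (Vec; []; _∷_; lookup; tabulate)
open import Data.Vec.Properties using (lookup∘tabulate; lookup⇒[]=; []=⇒lookup)
open import Data.Bool using (true; false; not)
open import Data.Bool.Properties using (∧-zeroʳ; ¬-not; not-¬) renaming (_≟_ to _≟ᵇ_)
open import Data.List using (List; []; _∷_; _++_; length)
open import Data.List.Relation.Unary.All using (All; []; _∷_)
import Data.List.Relation.Unary.All as All
open import Data.List.Relation.Unary.All.Properties using (++⁺)
open import Data.Product using (_×_; _,_; proj₁; proj₂; ∃-syntax; swap)
open import Data.Sum using (_⊎_; inj₁; inj₂; [_,_]′)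
open import Data.Empty using (⊥-elim)
open import Function.Bundles using (mk⇔)
open import Function using (_∘_; id)
open import Level using (Level; 0ℓ)
open import Relation.Nullary using (¬_; Dec; yes; no; does)
open import Relation.Nullary.Decidable using (¬?; _×-dec_; _⊎-dec_; dec-true; dec-false; decidable-stable)
open import Relation.Unary using (Pred; Decidable; _⊆_)
open import Relation.Binary.PropositionalEquality
  using (_≡_; _≢_; refl; sym; trans; cong; subst; ≢-sym)

private
  variable
    ℓ : Level
    m n : ℕ
    G H : Graph n
    a b c s t u v : Fin n
    ws : List (Fin n)

Adj-sym : Adj G u v → Adj G v u
Adj-sym {G = G} {u} {v} uv = trans (Graph.sym G v u) uv

Adj? : (G : Graph n) → ∀ u v → Dec (Adj G u v)
Adj? G u v = adj G u v ≟ᵇ true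

⟦_⟧ : {P : Pred (Fin n) ℓ} → Decidable P → VSet n
⟦ P? ⟧ v = does (P? v)

module _ {P : Pred (Fin n) ℓ} (P? : Decidable P) where

  ∈⟦⟧⁺ : P v → v ∈ₛ ⟦ P? ⟧
  ∈⟦⟧⁺ {v} = dec-true (P? v)

  ∈⟦⟧⁻ : v ∈ₛ ⟦ P? ⟧ → P v
  ∈⟦⟧⁻ {v} v∈ with P? v
  ... | yes p = p

  ∉⟦⟧⁺ : ¬ P v → ⟦ P? ⟧ v ≡ false
  ∉⟦⟧⁺ {v} = dec-false (P? v)

  ∉⟦⟧⁻ : ⟦ P? ⟧ v ≡ false → ¬ P v
  ∉⟦⟧⁻ {v} v∉ with P? v
  ... | no ¬p = ¬p

localComp-unchangedˡ : ∀ (G : Graph n) x → ¬ Adj G x u →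
                       adj (localComp G x) u v ≡ adj G u v
localComp-unchangedˡ G x x≁u rewrite ¬-not x≁u = refl

localComp-unchangedʳ : ∀ (G : Graph n) x → ¬ Adj G x v →
                       adj (localComp G x) u v ≡ adj G u v
localComp-unchangedʳ {u = u} G x x≁v rewrite ¬-not x≁v | ∧-zeroʳ (adj G x u) = refl

localComp-centre : ∀ (G : Graph n) x → adj (localComp G x) x v ≡ adj G x v
localComp-centre G x = localComp-unchangedˡ G x (not-¬ (irrefl G x))

localComp-flip : ∀ (G : Graph n) x → Adj G x u → Adj G x v → u ≢ v →
                 adj (localComp G x) u v ≡ not (adj G u v)
localComp-flip {u = u} {v = v} G x xu xv u≢v rewrite xu | xv with u ≟ v
... | yes u≡v = ⊥-elim (u≢v u≡v)
... | no _    = refl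

localComp-adds : ∀ (G : Graph n) x → Adj G x u → Adj G x v → u ≢ v →
                 ¬ Adj G u v → Adj (localComp G x) u v
localComp-adds G x xu xv u≢v u≁v = trans (localComp-flip G x xu xv u≢v) (cong not (¬-not u≁v))

localComp-removes : ∀ (G : Graph n) x → Adj G x u → Adj G x v → u ≢ v →
                    Adj G u v → ¬ Adj (localComp G x) u v
localComp-removes G x xu xv u≢v uv = not-¬ (trans (localComp-flip G x xu xv u≢v) (cong not uv))

localCompSeq-++ : ∀ (G : Graph n) xs ys →
                  localCompSeq G (xs ++ ys) ≡ localCompSeq (localCompSeq G xs) ys
localCompSeq-++ G []       ys = refl
localCompSeq-++ G (x ∷ xs) ys = localCompSeq-++ (localComp G x) xs ys

AvoidingWalk : Graph n → Fin n → Fin n → Fin n → Set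
AvoidingWalk G s u v = ∃[ ws ] (IsWalk G u ws v × All (_≢ s) ws)

IsWalk-localComp : ∀ (G : Graph n) x → All (¬_ ∘ Adj G x) ws →
                   IsWalk G u ws v → IsWalk (localComp G x) u ws v
IsWalk-localComp G x []            u≡v         = u≡v
IsWalk-localComp G x (x≁w ∷ x≁ws) (uw , walk) =
  trans (localComp-unchangedʳ G x x≁w) uw , IsWalk-localComp G x x≁ws walk

localComp-edge : ∀ (G : Graph n) x → Adj G u v →
                 Adj (localComp G x) u v ⊎ (Adj (localComp G x) u x × Adj (localComp G x) x v)
localComp-edge {u = u} {v = v} G x uv with Adj? G x u | Adj? G x v
... | no x≁u | _       = inj₁ (trans (localComp-unchangedˡ G x x≁u) uv)
... | yes _  | no x≁v  = inj₁ (trans (localComp-unchangedʳ G x x≁v) uv)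
... | yes xu | yes xv  = inj₂ ( Adj-sym {G = localComp G x} (trans (localComp-centre G x) xu)
                              , trans (localComp-centre G x) xv)

avoidingWalk-localComp : ∀ (G : Graph n) x → x ≢ s →
                         AvoidingWalk G s u v → AvoidingWalk (localComp G x) s u v
avoidingWalk-localComp G x x≢s ([] , u≡v , []) = [] , u≡v , []
avoidingWalk-localComp G x x≢s (w ∷ ws , (uw , walk) , w≢s ∷ avoid)
  with avoidingWalk-localComp G x x≢s (ws , walk , avoid) | localComp-edge G x uw
... | ws′ , walk′ , avoid′ | inj₁ uw′        = w ∷ ws′ , (uw′ , walk′) , w≢s ∷ avoid′
... | ws′ , walk′ , avoid′ | inj₂ (ux , xw) = x ∷ w ∷ ws′ , (ux , xw , walk′) , x≢s ∷ w≢s ∷ avoid′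

avoidingWalk-localCompSeq : ∀ (G : Graph n) {xs} → All (_≢ s) xs →
                            AvoidingWalk G s u v → AvoidingWalk (localCompSeq G xs) s u v
avoidingWalk-localCompSeq G []            walk = walk
avoidingWalk-localCompSeq G (x≢s ∷ xs≢s) walk =
  avoidingWalk-localCompSeq (localComp G _) xs≢s (avoidingWalk-localComp G _ x≢s walk)

-- Joining c to t along a walk avoiding s

Tame : Graph n → (c s t : Fin n) → List (Fin n) → Set
Tame H c s t xs = All (λ x → x ≢ s × x ≢ t) xs × (Adj H c s → Adj (localCompSeq H xs) c s)

tame-[] : ∀ (H : Graph n) c → Tame H c s t []
tame-[] H c = [] , λ cs → cs

tame-++ : ∀ {xs ys} → Tame H c s t xs → Tame (localCompSeq H xs) c s t ys → Tame H c s t (xs ++ ys)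
tame-++ {H = H} {c} {s} {xs = xs} {ys} (avoid₁ , keep₁) (avoid₂ , keep₂) =
  ++⁺ avoid₁ avoid₂ , λ cs → subst (λ K → Adj K c s) (sym (localCompSeq-++ H xs ys)) (keep₂ (keep₁ cs))

Joinable : Graph n → (c s t : Fin n) → Set
Joinable H c s t = ∃[ xs ] (Tame H c s t xs × Adj (localCompSeq H xs) c t)

Shortening : Graph n → (c s t : Fin n) → ℕ → Set
Shortening H c s t k =
  ∃[ xs ] (Tame H c s t xs ×
           ∃[ ws ] (length ws < k × IsWalk (localCompSeq H xs) c ws t × All (_≢ s) ws))

shortcut : ∀ {k} → length ws < k → IsWalk H c ws t → All (_≢ s) ws → Shortening H c s t k
shortcut {H = H} {c = c} shorter walk avoid = [] , tame-[] H c , _ , shorter , walk , avoid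

first-hit : {P : Pred (Fin n) ℓ} → Decidable P → IsWalk H u ws t → All (_≢ s) ws →
            All (¬_ ∘ P) ws ⊎
            ∃[ w ] ∃[ vs ] (P w × IsWalk H w vs t × All (_≢ s) (w ∷ vs) × length vs < length ws)
first-hit {ws = []}     P? _           []             = inj₁ []
first-hit {ws = w ∷ ws} P? (_ , walk) (w≢s ∷ avoid) with P? w | first-hit P? walk avoid
... | yes Pw | _       = inj₂ (w , ws , Pw , walk , w≢s ∷ avoid , n<1+n _)
... | no ¬Pw | inj₁ ¬P = inj₁ (¬Pw ∷ ¬P)
... | no _   | inj₂ (w′ , vs , Pw′ , walk′ , avoid′ , shorter) =
  inj₂ (w′ , vs , Pw′ , walk′ , avoid′ , m<n⇒m<1+n shorter)

localComp-shortcut : ∀ (H : Graph n) x {w} → Adj H c x → Adj H x w → ¬ Adj H c w → c ≢ w →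
                     All (¬_ ∘ Adj H x) ws → IsWalk H w ws t → IsWalk (localComp H x) c (w ∷ ws) t
localComp-shortcut H x cx xw c≁w c≢w x≁ws walk =
  localComp-adds H x (Adj-sym {G = H} cx) xw c≢w c≁w , IsWalk-localComp H x x≁ws walk

-- Complementing at v₁ joins c to v₂, but toggles c s when v₁ s is an edge;
-- complementing at c first deletes v₁ s whenever c s is an edge.
detour : ∀ (H : Graph n) {v₁ v₂} → c ≢ s → c ≢ t → v₁ ≢ s → v₁ ≢ t → c ≢ v₂ →
         Adj H c v₁ → Adj H v₁ v₂ → All (¬_ ∘ Adj H c) (v₂ ∷ ws) → All (¬_ ∘ Adj H v₁) ws →
         IsWalk H v₂ ws t → ∃[ xs ] (Tame H c s t xs × IsWalk (localCompSeq H xs) c (v₂ ∷ ws) t)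
detour {c = c} {s} H {v₁} c≢s c≢t v₁≢s v₁≢t c≢v₂ cv₁ v₁v₂ (c≁v₂ ∷ c≁ws) v₁≁ws walk
  with Adj? H v₁ s
... | no v₁≁s =
  v₁ ∷ [] , ((v₁≢s , v₁≢t) ∷ [] , λ cs → trans (localComp-unchangedʳ H v₁ v₁≁s) cs) ,
  localComp-shortcut H v₁ cv₁ v₁v₂ c≁v₂ c≢v₂ v₁≁ws walk
... | yes v₁s =
  c ∷ v₁ ∷ [] , ((c≢s , c≢t) ∷ (v₁≢s , v₁≢t) ∷ [] , keeps-cs) ,
  localComp-shortcut H′ v₁ (trans (localComp-centre H c) cv₁)
    (trans (localComp-unchangedʳ H c c≁v₂) v₁v₂)
    (λ cv₂ → c≁v₂ (trans (sym (localComp-centre H c)) cv₂)) c≢v₂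
    (All.zipWith (λ (c≁w , v₁≁w) v₁w → v₁≁w (trans (sym (localComp-unchangedʳ H c c≁w)) v₁w))
                 (c≁ws , v₁≁ws))
    (IsWalk-localComp H c c≁ws walk)
  where
    H′ = localComp H c
    keeps-cs : Adj H c s → Adj (localComp H′ v₁) c s
    keeps-cs cs = trans (localComp-unchangedʳ H′ v₁ (localComp-removes H c cv₁ cs v₁≢s v₁s))
                        (trans (localComp-centre H c) cs)

shorten-past : ∀ (H : Graph n) {v₁} → c ≢ s → c ≢ t → v₁ ≢ s → v₁ ≢ t → Adj H c v₁ →
               IsWalk H v₁ ws t → All (_≢ s) ws → All (¬_ ∘ Adj H c) ws →
               Shortening H c s t (suc (length ws))
shorten-past {ws = []} H c≢s c≢t v₁≢s v₁≢t cv₁ refl _ _ = ⊥-elim (v₁≢t refl)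
shorten-past {c = c} {ws = v₂ ∷ ws} H {v₁} c≢s c≢t v₁≢s v₁≢t cv₁ (v₁v₂ , walk) (v₂≢s ∷ avoid) c≁
  with first-hit (Adj? H v₁) walk avoid
... | inj₂ (w , vs , v₁w , walk′ , avoid′ , shorter) =
  shortcut (s<s (s<s shorter)) (cv₁ , v₁w , walk′) (v₁≢s ∷ avoid′)
... | inj₁ v₁≁ws with c ≟ v₂
...   | yes refl = shortcut (m<n⇒m<1+n (n<1+n _)) walk avoid
...   | no c≢v₂ with detour H c≢s c≢t v₁≢s v₁≢t c≢v₂ cv₁ v₁v₂ c≁ v₁≁ws walk
...     | xs , tame , walk′ = xs , tame , v₂ ∷ ws , n<1+n _ , walk′ , v₂≢s ∷ avoid

join-or-shorten : ∀ (H : Graph n) → c ≢ s → c ≢ t → IsWalk H c ws t → All (_≢ s) ws →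
                  Adj H c t ⊎ Shortening H c s t (length ws)
join-or-shorten {ws = []} H c≢s c≢t refl [] = ⊥-elim (c≢t refl)
join-or-shorten {c = c} {t = t} {ws = v₁ ∷ ws} H c≢s c≢t (cv₁ , walk) (v₁≢s ∷ avoid)
  with v₁ ≟ t | first-hit (Adj? H c) walk avoid
... | yes refl | _ = inj₁ cv₁
... | no _     | inj₂ (w , vs , cw , walk′ , avoid′ , shorter) =
  inj₂ (shortcut (s<s shorter) (cw , walk′) avoid′)
... | no v₁≢t  | inj₁ c≁ws = inj₂ (shorten-past H c≢s c≢t v₁≢s v₁≢t cv₁ walk avoid c≁ws)

joinable : ∀ (H : Graph n) → c ≢ s → c ≢ t → AvoidingWalk H s c t → Joinable H c s t
joinable {n = n} {c = c} {s} {t} H c≢s c≢t (ws , walk , avoid) = go H walk avoid (<-wellFounded _)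
  where
    go : ∀ (H : Graph n) {ws} → IsWalk H c ws t → All (_≢ s) ws → Acc _<_ (length ws) →
         Joinable H c s t
    go H walk avoid (acc shorter⇒acc) with join-or-shorten H c≢s c≢t walk avoid
    ... | inj₁ ct = [] , tame-[] H c , ct
    ... | inj₂ (xs , tame , _ , shorter , walk′ , avoid′)
      with go (localCompSeq H xs) walk′ avoid′ (shorter⇒acc shorter)
    ...   | ys , tame′ , ct =
      xs ++ ys , tame-++ tame tame′ , subst (λ K → Adj K c t) (sym (localCompSeq-++ H xs ys)) ct

-- Prime graphs stay connected after deleting a vertex

Missing : Vec (Fin n) m → Fin n → Set
Missing vs w = ∀ k → w ≢ lookup vs k

missing? : (vs : Vec (Fin n) m) → Decidable (Missing vs)
missing? vs w = all? (λ k → ¬? (w ≟ lookup vs k))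

none-missing⇒listed : (vs : Vec (Fin n) m) → ¬ (∃[ w ] Missing vs w) → ∀ w → ∃[ k ] w ≡ lookup vs k
none-missing⇒listed {m = m} vs none w
  with k , ¬w≢ ← ¬∀⟶∃¬ m _ (λ k → ¬? (w ≟ lookup vs k)) (λ w-missing → none (w , w-missing))
  = k , decidable-stable (w ≟ lookup vs k) ¬w≢

missing-vertex : (vs : Vec (Fin n) m) → m < n → ∃[ w ] Missing vs w
missing-vertex vs m<n with any? (missing? vs)
... | yes missing = missing
... | no none
  with listed ← none-missing⇒listed vs none
  with i , j , i<j , same ← pigeonhole m<n (proj₁ ∘ listed)
  = ⊥-elim (<⇒≢ i<j (trans (proj₂ (listed i)) (trans (cong (lookup vs) same) (sym (proj₂ (listed j))))))

fourth-vertex : 3 < n → (c s t : Fin n) → ∃[ w ] (w ≢ c × w ≢ s × w ≢ t)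
fourth-vertex 3<n c s t with w , w-missing ← missing-vertex (c ∷ s ∷ t ∷ []) 3<n
  = w , w-missing Fin.zero , w-missing (Fin.suc Fin.zero) , w-missing (Fin.suc (Fin.suc Fin.zero))

ascending-chain-stabilises : {P : ℕ → Pred (Fin n) ℓ} → (∀ k → Decidable (P k)) →
                             (∀ k → P k ⊆ P (suc k)) → ∃[ j ] P (suc j) ⊆ P j
ascending-chain-stabilises {n = n} {P = P} P? P⊆ =
  [ id , (λ n<∣S∣ → ⊥-elim (<⇒≱ n<∣S∣ (∣p∣≤n (S (suc n))))) ]′ (grow (suc n))
  where
    S : ℕ → Subset n
    S k = tabulate (does ∘ P? k)
    ∈S⁺ : ∀ {k x} → P k x → x Subset.∈ S k
    ∈S⁺ {k} {x} p = lookup⇒[]= x (S k) (trans (lookup∘tabulate _ x) (dec-true (P? k x) p))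
    ∈S⁻ : ∀ {k x} → x Subset.∈ S k → P k x
    ∈S⁻ {k} {x} x∈ = ∈⟦⟧⁻ (P? k) (trans (sym (lookup∘tabulate _ x)) ([]=⇒lookup x∈))
    grow : ∀ k → (∃[ j ] P (suc j) ⊆ P j) ⊎ k ≤ ∣ S k ∣
    grow zero    = inj₂ z≤n
    grow (suc k) with grow k | any? (λ x → P? (suc k) x ×-dec ¬? (P? k x))
    ... | inj₁ stable | _ = inj₁ stable
    ... | inj₂ k≤∣S∣ | yes (x , new , ¬old) =
      inj₂ (≤-<-trans k≤∣S∣ (p⊂q⇒∣p∣<∣q∣ ((∈S⁺ ∘ P⊆ k ∘ ∈S⁻) , x , ∈S⁺ new , ¬old ∘ ∈S⁻)))
    ... | inj₂ _ | no ¬new =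
      inj₁ (k , λ {x} p → decidable-stable (P? k x) (λ ¬old → ¬new (x , p , ¬old)))

ClosedAwayFrom : Graph n → Fin n → Pred (Fin n) ℓ → Set ℓ
ClosedAwayFrom G s N = ∀ {u v} → N u → Adj G u v → v ≢ s → N v

walk-crosses : {P : Pred (Fin n) ℓ} → Decidable P → IsWalk G u ws v → P u → ¬ P v →
               ∃[ x ] ∃[ y ] (P x × ¬ P y × Adj G x y)
walk-crosses {ws = []}                  P? refl        Pu ¬Pv = ⊥-elim (¬Pv Pu)
walk-crosses {u = u} {ws = w ∷ ws} P? (uw , walk) Pu ¬Pv with P? w
... | yes Pw = walk-crosses P? walk Pw ¬Pv
... | no ¬Pw = u , w , Pu , ¬Pw , uw

-- The split separates P from the rest, with X′ the neighbours of s in P and Y′ = {s}.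
closedAwayFrom-split : ∀ {P : Pred (Fin n) ℓ} {u₁ u₂ v₁ v₂} → Connected G → (P? : Decidable P) →
                       ClosedAwayFrom G s P → ¬ P s → u₁ ≢ u₂ → P u₁ → P u₂ →
                       v₁ ≢ v₂ → ¬ P v₁ → ¬ P v₂ → IsSplit G ⟦ P? ⟧
closedAwayFrom-split {G = G} {s = s} {P = P} {u₁} {u₂} {v₁} {v₂}
                     connected P? closed ¬Ps u₁≢u₂ Pu₁ Pu₂ v₁≢v₂ ¬Pv₁ ¬Pv₂ =
  (u₁ , u₂ , u₁≢u₂ , ∈⟦⟧⁺ P? Pu₁ , ∈⟦⟧⁺ P? Pu₂) ,
  (v₁ , v₂ , v₁≢v₂ , outside ¬Pv₁ , outside ¬Pv₂) ,
  ⟦ X′? ⟧ , ⟦ _≟ s ⟧ ,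
  (λ x x∈X′ → ∈⟦⟧⁺ P? (proj₁ (∈⟦⟧⁻ X′? x∈X′))) ,
  (λ y y∈Y′ → outside (λ Py → ¬Ps (subst P (∈⟦⟧⁻ (_≟ s) y∈Y′) Py))) ,
  X′-nonempty , (s , ∈⟦⟧⁺ (_≟ s) refl) ,
  λ x y x∈X y∉X → mk⇔ (edge-from-s (∈⟦⟧⁻ P? x∈X) (∉⟦⟧⁻ P? y∉X)) edge-to-s
  where
    outside : ∀ {v} → ¬ P v → not (⟦ P? ⟧ v) ≡ true
    outside ¬Pv = cong not (∉⟦⟧⁺ P? ¬Pv)

    X′? : Decidable (λ v → P v × Adj G v s)
    X′? v = P? v ×-dec Adj? G v s

    exits-at-s : ∀ {u v} → P u → Adj G u v → ¬ P v → v ≡ s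
    exits-at-s {v = v} Pu uv ¬Pv with v ≟ s
    ... | yes v≡s = v≡s
    ... | no v≢s  = ⊥-elim (¬Pv (closed Pu uv v≢s))

    X′-nonempty : NonEmpty ⟦ X′? ⟧
    X′-nonempty with x , y , Px , ¬Py , xy ← walk-crosses P? (proj₂ (connected u₁ v₁)) Pu₁ ¬Pv₁
      = x , ∈⟦⟧⁺ X′? (Px , subst (Adj G x) (exits-at-s Px xy ¬Py) xy)

    edge-from-s : ∀ {x y} → P x → ¬ P y → Adj G x y → x ∈ₛ ⟦ X′? ⟧ × y ∈ₛ ⟦ _≟ s ⟧
    edge-from-s {x} Px ¬Py xy with y≡s ← exits-at-s Px xy ¬Py
      = ∈⟦⟧⁺ X′? (Px , subst (Adj G x) y≡s xy) , ∈⟦⟧⁺ (_≟ s) y≡s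

    edge-to-s : ∀ {x y} → x ∈ₛ ⟦ X′? ⟧ × y ∈ₛ ⟦ _≟ s ⟧ → Adj G x y
    edge-to-s {x} (x∈X′ , y∈Y′) = subst (Adj G x) (sym (∈⟦⟧⁻ (_≟ s) y∈Y′)) (proj₂ (∈⟦⟧⁻ X′? x∈X′))

Rest : Pred (Fin n) ℓ → Fin n → Pred (Fin n) ℓ
Rest N s v = ¬ (N v ⊎ v ≡ s)

rest? : {N : Pred (Fin n) ℓ} → Decidable N → ∀ s → Decidable (Rest N s)
rest? N? s v = ¬? (N? v ⊎-dec v ≟ s)

closedAwayFrom-rest : {N : Pred (Fin n) ℓ} → ClosedAwayFrom G s N → ClosedAwayFrom G s (Rest N s)
closedAwayFrom-rest {G = G} closed rest-u uv v≢s (inj₁ Nv) =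
  rest-u (inj₁ (closed Nv (Adj-sym {G = G} uv) (λ u≡s → rest-u (inj₂ u≡s))))
closedAwayFrom-rest closed rest-u uv v≢s (inj₂ v≡s) = v≢s v≡s

prime-closedAwayFrom⇒full : Prime G → 3 < n → {N : Pred (Fin n) ℓ} → Decidable N →
                            ClosedAwayFrom G s N → N t → ¬ N s → c ≢ s → N c
prime-closedAwayFrom⇒full {G = G} {s = s} {t = t} {c = c}
                          (connected , no-split) 3<n {N} N? closed Nt ¬Ns c≢s with N? c
... | yes Nc = Nc
... | no ¬Nc
  with w , w≢c , w≢s , w≢t ← fourth-vertex 3<n c s t
  with N? w
... | yes Nw = ⊥-elim (no-split _
        (closedAwayFrom-split connected N? closed ¬Ns (≢-sym w≢t) Nt Nw (≢-sym c≢s) ¬Ns ¬Nc))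
... | no ¬Nw = ⊥-elim (no-split _
        (closedAwayFrom-split connected (rest? N? s) (closedAwayFrom-rest {G = G} closed)
           (λ rest-s → rest-s (inj₂ refl))
           (≢-sym w≢c) [ ¬Nc , c≢s ]′ [ ¬Nw , w≢s ]′
           s≢t (λ rest-s → rest-s (inj₂ refl)) (λ rest-t → rest-t (inj₁ Nt))))
  where
    s≢t : s ≢ t
    s≢t s≡t = ¬Ns (subst N (sym s≡t) Nt)

module _ (G : Graph n) (s t : Fin n) where

  Near : ℕ → Pred (Fin n) 0ℓ
  Near zero    v = v ≡ t
  Near (suc k) v = Near k v ⊎ (v ≢ s × ∃[ u ] (Adj G v u × Near k u))

  near? : ∀ k → Decidable (Near k)
  near? zero    v = v ≟ t
  near? (suc k) v = near? k v ⊎-dec ¬? (v ≟ s) ×-dec any? (λ u → Adj? G v u ×-dec near? k u)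

  near-target : ∀ k → Near k t
  near-target zero    = refl
  near-target (suc k) = inj₁ (near-target k)

  near⇒avoidingWalk : t ≢ s → ∀ {k v} → Near k v → v ≢ s × AvoidingWalk G s v t
  near⇒avoidingWalk t≢s {zero}  refl     = t≢s , [] , refl , []
  near⇒avoidingWalk t≢s {suc k} (inj₁ near) = near⇒avoidingWalk t≢s near
  near⇒avoidingWalk t≢s {suc k} (inj₂ (v≢s , u , vu , near))
    with u≢s , ws , walk , avoid ← near⇒avoidingWalk t≢s near
    = v≢s , u ∷ ws , (vu , walk) , u≢s ∷ avoid

  stable⇒closedAwayFrom : ∀ {j} → Near (suc j) ⊆ Near j → ClosedAwayFrom G s (Near j)
  stable⇒closedAwayFrom stable Nu uv v≢s = stable (inj₂ (v≢s , _ , Adj-sym {G = G} uv , Nu))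

prime⇒avoidingWalk : {G : Graph n} → Prime G → 3 < n → c ≢ s → s ≢ t → AvoidingWalk G s c t
prime⇒avoidingWalk {s = s} {t = t} {G = G} prime 3<n c≢s s≢t
  with j , stable ← ascending-chain-stabilises (near? G s t) (λ _ → inj₁)
  = proj₂ (near⇒avoidingWalk G s t t≢s
      (prime-closedAwayFrom⇒full prime 3<n (near? G s t j) (stable⇒closedAwayFrom G s t stable)
         (near-target G s t j) (λ Ns → proj₁ (near⇒avoidingWalk G s t t≢s Ns) refl) c≢s))
  where
    t≢s = ≢-sym s≢t

common-neighbour⇒inducedPath : ∀ (H : Graph n) → c ≢ a → c ≢ b → a ≢ b → Adj H c a → Adj H c b →
  ∃[ ys ] (All (λ x → x ≢ a × x ≢ b) ys × InducedPath (localCompSeq H ys) a c b)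
common-neighbour⇒inducedPath {c = c} {a} {b} H c≢a c≢b a≢b ca cb with Adj? H a b
... | no a≁b = [] , [] , Adj-sym {G = H} ca , cb , ¬-not a≁b
... | yes ab = c ∷ [] , (c≢a , c≢b) ∷ [] ,
  Adj-sym {G = localComp H c} (trans (localComp-centre H c) ca) ,
  trans (localComp-centre H c) cb ,
  ¬-not (localComp-removes H c ca cb a≢b ab)

inducedPath-by-localComps :
  ∀ {G : Graph n} → Prime G → 3 < n → c ≢ a → c ≢ b → a ≢ b →
  ∃[ xs ] (All (λ x → x ≢ a × x ≢ b) xs × InducedPath (localCompSeq G xs) a c b)
inducedPath-by-localComps {c = c} {a} {b} {G} prime 3<n c≢a c≢b a≢b
  with xs₁ , (avoid₁ , _) , ca₁ ← joinable G c≢b c≢a (prime⇒avoidingWalk prime 3<n c≢b (≢-sym a≢b))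
  with xs₂ , (avoid₂ , keep-ca) , cb₂ ←
         joinable (localCompSeq G xs₁) c≢a c≢b
           (avoidingWalk-localCompSeq G (All.map proj₂ avoid₁) (prime⇒avoidingWalk prime 3<n c≢a a≢b))
  with ys , avoid₃ , path ← common-neighbour⇒inducedPath (localCompSeq (localCompSeq G xs₁) xs₂)
                               c≢a c≢b a≢b (keep-ca ca₁) cb₂
  = xs₁ ++ xs₂ ++ ys , ++⁺ (All.map swap avoid₁) (++⁺ avoid₂ avoid₃) ,
    subst (λ K → InducedPath K a c b)
          (sym (trans (localCompSeq-++ G xs₁ (xs₂ ++ ys)) (localCompSeq-++ (localCompSeq G xs₁) xs₂ ys)))
          path

lemma4p4 : ∀ {n : ℕ} (G : Graph n) → Prime G → 5 ≤ n →
           (a b c : Fin n) → a ≢ b → b ≢ c → a ≢ c →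
           ∃[ xs ] (All (λ x → x ≢ a × x ≢ b) xs × InducedPath (localCompSeq G xs) a c b)
lemma4p4 G prime 5≤n a b c a≢b b≢c a≢c =
  inducedPath-by-localComps prime (<⇒≤ 5≤n) (≢-sym a≢c) (≢-sym b≢c) a≢b
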